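{- Let $G$ be a finite group, $H\le G$, and $\mathcal{J}=\{J_1,\dots,J_\ell\}$ non-trivial subgroups of $G$ such that $G$ admits a generalised norm relation over $\mathbb{Q}$ with respect to $H$ and $\mathcal{J}$. Then there exist a positive integer $c$, integers $n_1,\dots,n_\ell\in\mathbb{N}$, an injective $\mathbb{Z}[G]$-module morphism $\psi:\mathbb{Z}[G/H]\to\bigoplus_i\mathbb{Z}[G/J_i]^{n_i}$ and a $\mathbb{Z}[G]$-module morphism $\phi:\bigoplus_i\mathbb{Z}[G/J_i]^{n_i}\to\mathbb{Z}[G/H]$ whose image has finite index in $\mathbb{Z}[G/H]$, such that $\phi\circ\psi=c\cdot\mathrm{id}$. In particular the optimal coefficient $c(\mathcal{J},H)$ is well defined.
   Context: $N_U=\sum_{u\in U}u$. A generalised norm relation over $\mathbb{Q}$ with respect to $H$ and $\mathcal{J}$ is an equality $N_H=\sum_k a_kN_{J_{i_k}}b_k$ in $\mathbb{Q}[G]$ with $a_k,b_k\in\mathbb{Q}[G]$, $J_{i_k}\in\mathcal{J}$, $J_{i_k}\neq1$. The optimal coefficient $c(\mathcal{J},H)$ is the smallest positive integer $c$ for which $n_i,\psi,\phi$ as in the claim exist. -}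

module Defs where

open import Data.Nat as ℕ using (ℕ; zero; suc)
open import Data.Fin using (Fin; zero; suc)
open import Data.Fin.Subset using (Subset; Side; inside; outside; _∈_)
open import Data.Vec using (lookup)
open import Data.Integer as ℤ using (ℤ; +_)
open import Data.Rational as ℚ using (ℚ; 0ℚ; 1ℚ)
open import Data.Product using (Σ; ∃; _×_; _,_; proj₁; proj₂)
open import Data.List using (List)
open import Data.List.Relation.Unary.Any using (Any)
open import Algebra.Structures using (IsGroup)
open import Relation.Binary.PropositionalEquality
  using (_≡_; _≢_; refl; sym; trans; cong; cong₂)

-- Finite groups: a group structure (with propositional equality) on
-- Fin n.  Every finite group is isomorphic to one of these.

record FinGroup : Set where
  infixl 7 _·_
  field
    n       : ℕ
    _·_     : Fin n → Fin n → Fin n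
    ε       : Fin n
    _⁻¹     : Fin n → Fin n
    isGroup : IsGroup _≡_ _·_ ε _⁻¹
  open IsGroup isGroup public using (assoc)

module _ (G : FinGroup) where
  open FinGroup G

  record IsSubgroup (H : Subset n) : Set where
    field
      ε∈  : ε ∈ H
      ·∈  : ∀ {x y} → x ∈ H → y ∈ H → (x · y) ∈ H
      ⁻¹∈ : ∀ {x} → x ∈ H → (x ⁻¹) ∈ H

  NonTrivial : Subset n → Set
  NonTrivial J = ∃ λ g → g ∈ J × g ≢ ε

sumℚ : ∀ {m} → (Fin m → ℚ) → ℚ
sumℚ {zero}  f = 0ℚ
sumℚ {suc m} f = f zero ℚ.+ sumℚ (λ i → f (suc i))

module _ (G : FinGroup) where
  open FinGroup G

  QG : Set
  QG = Fin n → ℚ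

  _*G_ : QG → QG → QG
  (a *G b) g = sumℚ (λ h → a h ℚ.* b ((h ⁻¹) · g))

  sideℚ : Side → ℚ
  sideℚ inside  = 1ℚ
  sideℚ outside = 0ℚ

  Norm : Subset n → QG
  Norm U g = sideℚ (lookup U g)

  -- G admits a generalised norm relation over ℚ w.r.t. H and J:
  -- N_H = Σ_k a_k N_{J_{i_k}} b_k in ℚ[G]  (the J_i are nontrivial
  -- by a separate hypothesis)
  NormRelation : Subset n → (ℓ : ℕ) → (Fin ℓ → Subset n) → Set
  NormRelation H ℓ J =
    Σ ℕ λ K → Σ (Fin K → Fin ℓ) λ idx → Σ (Fin K → QG) λ a → Σ (Fin K → QG) λ b →
      ∀ g → Norm H g ≡ sumℚ (λ k → ((a k *G Norm (J (idx k))) *G b k) g)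

-- ℤ[G]-modules (enough structure to talk about morphisms)

record ZGMod (G : FinGroup) : Set₁ where
  open FinGroup G
  field
    Carrier : Set
    _≈_     : Carrier → Carrier → Set
    _+_     : Carrier → Carrier → Carrier
    act     : Fin n → Carrier → Carrier
    scal    : ℤ → Carrier → Carrier

module _ {G : FinGroup} (M N : ZGMod G) where
  open FinGroup G
  private
    module M = ZGMod M
    module N = ZGMod N

  -- ℤ[G]-module morphism (additive, hence ℤ-linear, and G-equivariant)
  record IsHom (f : M.Carrier → N.Carrier) : Set where
    field
      cong-≈ : ∀ {x y} → x M.≈ y → f x N.≈ f y
      hom-+  : ∀ x y → f (x M.+ y) N.≈ (f x N.+ f y)
      hom-G  : ∀ g x → f (M.act g x) N.≈ N.act g (f x)

  Injective : (M.Carrier → N.Carrier) → Set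
  Injective f = ∀ x y → f x N.≈ f y → x M.≈ y

  FiniteIndexImage : (M.Carrier → N.Carrier) → Set
  FiniteIndexImage f =
    Σ (List N.Carrier) λ L → ∀ x → Any (λ y → ∃ λ z → x N.≈ (y N.+ f z)) L

-- Permutation modules ℤ[G/H], modelled as functions G → ℤ constant on
-- left cosets gH (basis: indicator functions of cosets), with
-- G acting by (g ▸ f)(x) = f(g⁻¹ x).

module _ (G : FinGroup) where
  open FinGroup G

  Perm : Subset n → Set
  Perm H = Σ (Fin n → ℤ) λ f → ∀ g h → h ∈ H → f (g · h) ≡ f g

  _≈P_ : ∀ {H} → Perm H → Perm H → Set
  x ≈P y = ∀ g → proj₁ x g ≡ proj₁ y g

  _+P_ : ∀ {H} → Perm H → Perm H → Perm H
  (f , p) +P (f' , p') = (λ g → f g ℤ.+ f' g) , λ g h h∈ → cong₂ ℤ._+_ (p g h h∈) (p' g h h∈)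

  actP : ∀ {H} → Fin n → Perm H → Perm H
  actP g (f , p) = (λ x → f ((g ⁻¹) · x)) ,
    λ x h h∈ → trans (cong f (sym (assoc (g ⁻¹) x h))) (p ((g ⁻¹) · x) h h∈)

  scalP : ∀ {H} → ℤ → Perm H → Perm H
  scalP c (f , p) = (λ g → c ℤ.* f g) , λ g h h∈ → cong (c ℤ.*_) (p g h h∈)

  PermMod : Subset n → ZGMod G
  PermMod H = record
    { Carrier = Perm H ; _≈_ = _≈P_ ; _+_ = _+P_ ; act = actP ; scal = scalP }

  SumMod : (ℓ : ℕ) → (Fin ℓ → Subset n) → (Fin ℓ → ℕ) → ZGMod G
  SumMod ℓ J ns = record
    { Carrier = (i : Fin ℓ) → Fin (ns i) → Perm (J i)
    ; _≈_     = λ x y → ∀ i k → x i k ≈P y i k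
    ; _+_     = λ x y i k → x i k +P y i k
    ; act     = λ g x i k → actP g (x i k)
    ; scal    = λ c x i k → scalP c (x i k)
    }

-- Clearing denominators turns the norm relation into Σ_k A_k N_{J_{i_k}} B_k = d N_H in ℤ[G]
-- with d ≠ 0.  Model ℤ[G/H] as the right H-invariant functions on G.  Right convolution with
-- A_k N_{J_i} maps it into ℤ[G/J_i], right convolution with B_k N_H maps ℤ[G/J_i] back, and
-- summing over k the composite is right convolution with d N_H N_H = d |H| N_H, which acts on
-- ℤ[G/H] as multiplication by c = d |H|².  Hence ψ is injective and the image of φ contains
-- c ℤ[G/H], whose index is finite.
module Submission where

open import Defs
open import Data.Nat using (ℕ; _≤_)
open import Data.Fin using (Fin)
open import Data.Fin.Subset using (Subset)
open import Data.Integer using (+_)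
open import Data.Product using (Σ; _×_)

open import Level using (0ℓ)
open import Function using (_∘_)
open import Algebra.Core using (Op₁; Op₂)
open import Algebra.Bundles using (Group; CommutativeRing)
open import Algebra.Structures using (IsCommutativeRing)
import Algebra.Properties.Semiring.Sum
open import Data.Nat as ℕ using (zero; suc)
import Data.Nat.Properties as ℕ
open import Data.Nat.Divisibility using (_∣_; divides)
open import Data.Nat.ListAction using (product)
open import Data.Nat.ListAction.Properties using (∈⇒∣product; product≢0)
open import Data.Integer as ℤ using (ℤ)
import Data.Integer.Properties as ℤ
open import Data.Integer.DivMod using (_%ℕ_; _/ℕ_; n%ℕd<d; a≡a%ℕn+[a/ℕn]*n)
open import Data.Integer.Tactic.RingSolver using (solve-∀)
open import Data.Rational as ℚ using (ℚ; toℚᵘ; fromℚᵘ; ↥_; ↧_; ↧ₙ_)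
import Data.Rational.Properties as ℚ
open import Data.Rational.Unnormalised as ℚᵘ using (mkℚᵘ; *≡*)
import Data.Rational.Unnormalised.Properties as ℚᵘ
open import Data.Fin using (zero; suc; toℕ; fromℕ<)
import Data.Fin.Properties as Fin
open import Data.Fin.Permutation using (permutation)
open import Data.Fin.Subset using (Side; inside; outside; _∈_; ∣_∣)
open import Data.Fin.Subset.Properties using (_∈?_)
open import Data.Vec using (Vec; []; _∷_; here; there; lookup; tabulate)
open import Data.Vec.Properties using ([]=⇒lookup; lookup⇒[]=; lookup∘tabulate)
open import Data.List using (List; []; _∷_; map; cartesianProductWith; allFin)
import Data.List.Membership.Propositional as List
open import Data.List.Membership.Propositional.Properties
  using (∈-map⁺; ∈-cartesianProductWith⁺; ∈-allFin)
import Data.List.Relation.Unary.All as All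
import Data.List.Relation.Unary.All.Properties as All
open import Data.List.Relation.Unary.Any using (here)
open import Data.Product using (_,_; proj₁; proj₂)
open import Data.Empty using (⊥-elim)
open import Relation.Nullary using (Dec; yes; no)
open import Relation.Nullary.Decidable using (_→-dec_)
open import Relation.Binary.PropositionalEquality

lookup-cong-∈ : ∀ {m} (U : Subset m) {x y : Fin m} →
  (x ∈ U → y ∈ U) → (y ∈ U → x ∈ U) → lookup U x ≡ lookup U y
lookup-cong-∈ U {x} {y} x⇒y y⇒x with lookup U x in ex | lookup U y in ey
... | inside  | inside  = refl
... | outside | outside = refl
... | inside  | outside = trans (sym ([]=⇒lookup (x⇒y (lookup⇒[]= x U ex)))) ey
... | outside | inside  = trans (sym ex) ([]=⇒lookup (y⇒x (lookup⇒[]= y U ey)))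

module FinGroupProperties (G : FinGroup) where
  open FinGroup G

  group : Group 0ℓ 0ℓ
  group = record { isGroup = isGroup }

  open Group group public using (identityʳ; inverseˡ)

  open import Algebra.Properties.Group group public
    using (\\-leftDividesˡ; \\-leftDividesʳ; //-rightDividesʳ; ⁻¹-involutive; ⁻¹-anti-homo-∙)

  ⁻¹-·-assoc : ∀ g h x → (g · h) ⁻¹ · x ≡ h ⁻¹ · (g ⁻¹ · x)
  ⁻¹-·-assoc g h x = trans (cong (_· x) (⁻¹-anti-homo-∙ g h)) (assoc (h ⁻¹) (g ⁻¹) x)

  ⁻¹-·-cancelʳ : ∀ x m → (x · m) ⁻¹ · x ≡ m ⁻¹
  ⁻¹-·-cancelʳ x m = trans (⁻¹-·-assoc x m x)
    (trans (cong (m ⁻¹ ·_) (inverseˡ x)) (identityʳ (m ⁻¹)))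

  module _ {U : Subset n} (U≤G : IsSubgroup G U) where
    open IsSubgroup U≤G

    lookup-·ʳ : ∀ y {j} → j ∈ U → lookup U (y · j) ≡ lookup U y
    lookup-·ʳ y {j} j∈U = lookup-cong-∈ U
      (λ yj∈U → subst (_∈ U) (//-rightDividesʳ j y) (·∈ yj∈U (⁻¹∈ j∈U)))
      (λ y∈U → ·∈ y∈U j∈U)

    lookup-⁻¹ : ∀ x → lookup U (x ⁻¹) ≡ lookup U x
    lookup-⁻¹ x = lookup-cong-∈ U
      (λ x⁻¹∈U → subst (_∈ U) (⁻¹-involutive x) (⁻¹∈ x⁻¹∈U))
      ⁻¹∈

module GroupAlgebra {A : Set} {add mul : Op₂ A} {neg : Op₁ A} {zeroᴬ oneᴬ : A}
  (isCommutativeRing : IsCommutativeRing _≡_ add mul neg zeroᴬ oneᴬ) (G : FinGroup) where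
  open FinGroup G
  open FinGroupProperties G

  ring : CommutativeRing 0ℓ 0ℓ
  ring = record { isCommutativeRing = isCommutativeRing }

  open CommutativeRing ring
    using (_+_; _*_; 0#; 1#; *-assoc; *-comm; *-identityˡ; *-identityʳ; distribʳ; zeroˡ; zeroʳ)

  private
    module Sum = Algebra.Properties.Semiring.Sum (CommutativeRing.semiring ring)

  -- Opaque, so that unification never unfolds a sum into a fold and loses the summand.
  opaque
    sum : ∀ {m} → (Fin m → A) → A
    sum = Sum.sum

    sum-zero : (f : Fin 0 → A) → sum f ≡ 0#
    sum-zero f = refl

    sum-suc : ∀ {m} (f : Fin (suc m) → A) → sum f ≡ f zero + sum (f ∘ suc)
    sum-suc f = refl

    sum-cong-≗ : ∀ {m} {f g : Fin m → A} → f ≗ g → sum f ≡ sum g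
    sum-cong-≗ = Sum.sum-cong-≗

    ∑-distrib-+ : ∀ {m} (f g : Fin m → A) → sum (λ i → f i + g i) ≡ sum f + sum g
    ∑-distrib-+ = Sum.∑-distrib-+

    ∑-comm : ∀ {m k} (f : Fin m → Fin k → A) →
      sum (λ i → sum (λ j → f i j)) ≡ sum (λ j → sum (λ i → f i j))
    ∑-comm = Sum.∑-comm

    *-distribˡ-sum : ∀ {m} c (f : Fin m → A) → c * sum f ≡ sum (λ i → c * f i)
    *-distribˡ-sum = Sum.*-distribˡ-sum

    *-distribʳ-sum : ∀ {m} c (f : Fin m → A) → sum f * c ≡ sum (λ i → f i * c)
    *-distribʳ-sum = Sum.*-distribʳ-sum

    sum-reindex-·ˡ : ∀ g (f : Fin n → A) → sum f ≡ sum (λ h → f (g · h))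
    sum-reindex-·ˡ g f =
      Sum.sum-permute f (permutation (g ·_) (g ⁻¹ ·_) (\\-leftDividesˡ g) (\\-leftDividesʳ g))

  infixl 7 _∗_

  _∗_ : (Fin n → A) → (Fin n → A) → Fin n → A
  (a ∗ b) x = sum (λ h → a h * b (h ⁻¹ · x))

  side : Side → A
  side inside  = 1#
  side outside = 0#

  𝟙 : ∀ {m} → Subset m → Fin m → A
  𝟙 U g = side (lookup U g)

  RightInvariant : Subset n → (Fin n → A) → Set
  RightInvariant U f = ∀ g h → h ∈ U → f (g · h) ≡ f g

  ∗-cong : ∀ {a a' b b'} → a ≗ a' → b ≗ b' → a ∗ b ≗ a' ∗ b'
  ∗-cong a≗a' b≗b' x = sum-cong-≗ (λ h → cong₂ _*_ (a≗a' h) (b≗b' _))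

  ∗-congˡ : ∀ a {b b'} → b ≗ b' → a ∗ b ≗ a ∗ b'
  ∗-congˡ a = ∗-cong {a} (λ _ → refl)

  ∗-congʳ : ∀ b {a a'} → a ≗ a' → a ∗ b ≗ a' ∗ b
  ∗-congʳ b a≗a' = ∗-cong {b = b} a≗a' (λ _ → refl)

  ∗-assoc : ∀ a b c → (a ∗ b) ∗ c ≗ a ∗ (b ∗ c)
  ∗-assoc a b c x = begin
    sum (λ h → sum (λ k → a k * b (k ⁻¹ · h)) * c (h ⁻¹ · x))
      ≡⟨ sum-cong-≗ (λ h → *-distribʳ-sum (c (h ⁻¹ · x)) (λ k → a k * b (k ⁻¹ · h))) ⟩
    sum (λ h → sum (λ k → a k * b (k ⁻¹ · h) * c (h ⁻¹ · x)))
      ≡⟨ ∑-comm (λ h k → a k * b (k ⁻¹ · h) * c (h ⁻¹ · x)) ⟩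
    sum (λ k → sum (λ h → a k * b (k ⁻¹ · h) * c (h ⁻¹ · x)))
      ≡⟨ sum-cong-≗ (λ k → sum-reindex-·ˡ k _) ⟩
    sum (λ k → sum (λ m → a k * b (k ⁻¹ · (k · m)) * c ((k · m) ⁻¹ · x)))
      ≡⟨ sum-cong-≗ (λ k → sum-cong-≗ (λ m →
           trans (cong₂ (λ u v → a k * b u * c v) (\\-leftDividesʳ k m) (⁻¹-·-assoc k m x))
                 (*-assoc (a k) _ _))) ⟩
    sum (λ k → sum (λ m → a k * (b m * c (m ⁻¹ · (k ⁻¹ · x)))))
      ≡⟨ sum-cong-≗ (λ k → sym (*-distribˡ-sum (a k) (λ m → b m * c (m ⁻¹ · (k ⁻¹ · x))))) ⟩
    sum (λ k → a k * (b ∗ c) (k ⁻¹ · x)) ∎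
    where open ≡-Reasoning

  ∗-distribʳ-+ : ∀ a a' b → (λ y → a y + a' y) ∗ b ≗ λ x → (a ∗ b) x + (a' ∗ b) x
  ∗-distribʳ-+ a a' b x =
    trans (sum-cong-≗ (λ h → distribʳ _ (a h) (a' h)))
          (∑-distrib-+ (λ h → a h * b (h ⁻¹ · x)) (λ h → a' h * b (h ⁻¹ · x)))

  ∗-scaleˡ : ∀ c a b → (λ y → c * a y) ∗ b ≗ λ x → c * (a ∗ b) x
  ∗-scaleˡ c a b x =
    trans (sum-cong-≗ (λ h → *-assoc c (a h) _)) (sym (*-distribˡ-sum c (λ h → a h * b (h ⁻¹ · x))))

  ∗-scaleʳ : ∀ c a b → a ∗ (λ y → c * b y) ≗ λ x → c * (a ∗ b) x
  ∗-scaleʳ c a b x = trans (sum-cong-≗ swap) (sym (*-distribˡ-sum c (λ h → a h * b (h ⁻¹ · x))))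
    where
    swap : ∀ h → a h * (c * b (h ⁻¹ · x)) ≡ c * (a h * b (h ⁻¹ · x))
    swap h = trans (sym (*-assoc (a h) c _))
      (trans (cong (_* b (h ⁻¹ · x)) (*-comm (a h) c)) (*-assoc c (a h) _))

  ∗-scale : ∀ c d a b → (λ y → c * a y) ∗ (λ y → d * b y) ≗ λ x → c * d * (a ∗ b) x
  ∗-scale c d a b x = begin
    ((λ y → c * a y) ∗ (λ y → d * b y)) x  ≡⟨ ∗-scaleʳ d (λ y → c * a y) b x ⟩
    d * ((λ y → c * a y) ∗ b) x            ≡⟨ cong (d *_) (∗-scaleˡ c a b x) ⟩
    d * (c * (a ∗ b) x)                    ≡⟨ *-assoc d c _ ⟨
    d * c * (a ∗ b) x                      ≡⟨ cong (_* (a ∗ b) x) (*-comm d c) ⟩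
    c * d * (a ∗ b) x                      ∎
    where open ≡-Reasoning

  ∗-sumˡ : ∀ {K} (a : Fin K → Fin n → A) b →
    (λ y → sum (λ k → a k y)) ∗ b ≗ λ x → sum (λ k → (a k ∗ b) x)
  ∗-sumˡ a b x =
    trans (sum-cong-≗ (λ h → *-distribʳ-sum _ (λ k → a k h)))
          (∑-comm (λ h k → a k h * b (h ⁻¹ · x)))

  ∗-sumʳ : ∀ {K} a (b : Fin K → Fin n → A) →
    a ∗ (λ y → sum (λ k → b k y)) ≗ λ x → sum (λ k → (a ∗ b k) x)
  ∗-sumʳ a b x =
    trans (sum-cong-≗ (λ h → *-distribˡ-sum (a h) (λ k → b k (h ⁻¹ · x))))
          (∑-comm (λ h k → a h * b k (h ⁻¹ · x)))

  ∗-translateˡ : ∀ g a b → (λ y → a (g ⁻¹ · y)) ∗ b ≗ λ x → (a ∗ b) (g ⁻¹ · x)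
  ∗-translateˡ g a b x = trans (sum-reindex-·ˡ g _) (sum-cong-≗ (λ m →
    cong₂ (λ u v → a u * b v) (\\-leftDividesʳ g m) (⁻¹-·-assoc g m x)))

  ∗-rightInvariant : ∀ {U} a {b} → RightInvariant U b → RightInvariant U (a ∗ b)
  ∗-rightInvariant a {b} b-inv x j j∈U = sum-cong-≗ (λ h →
    cong (a h *_) (trans (cong b (sym (assoc (h ⁻¹) x j))) (b-inv _ j j∈U)))

  𝟙-rightInvariant : ∀ {U} → IsSubgroup G U → RightInvariant U (𝟙 U)
  𝟙-rightInvariant U≤G y j j∈U = cong side (lookup-·ʳ U≤G y j∈U)

  𝟙-masks : ∀ {m} {U : Subset m} x {u v : A} → (x ∈ U → u ≡ v) → u * 𝟙 U x ≡ 𝟙 U x * v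
  𝟙-masks {U = U} x u≡v with lookup U x in e
  ... | inside  = trans (*-identityʳ _) (trans (u≡v (lookup⇒[]= x U e)) (sym (*-identityˡ _)))
  ... | outside = trans (zeroʳ _) (sym (zeroˡ _))

  -- Substituting h = x m gives Σ_m f (x m) 𝟙 U (m⁻¹), and f (x m) = f x whenever m ∈ U.
  ∗-𝟙 : ∀ {U} → IsSubgroup G U → ∀ {f} → RightInvariant U f →
    f ∗ 𝟙 U ≗ λ x → sum (𝟙 U) * f x
  ∗-𝟙 {U} U≤G {f} f-inv x = begin
    sum (λ h → f h * 𝟙 U (h ⁻¹ · x))         ≡⟨ sum-reindex-·ˡ x _ ⟩
    sum (λ m → f (x · m) * 𝟙 U ((x · m) ⁻¹ · x)) ≡⟨ sum-cong-≗ term ⟩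
    sum (λ m → 𝟙 U m * f x)                   ≡⟨ *-distribʳ-sum (f x) (𝟙 U) ⟨
    sum (𝟙 U) * f x ∎
    where
    open ≡-Reasoning
    term : ∀ m → f (x · m) * 𝟙 U ((x · m) ⁻¹ · x) ≡ 𝟙 U m * f x
    term m = trans (cong (λ y → f (x · m) * 𝟙 U y) (⁻¹-·-cancelʳ x m))
      (trans (cong (f (x · m) *_) (cong side (lookup-⁻¹ U≤G m)))
        (𝟙-masks m (f-inv x m)))

fromℚᵘ-homo-+ : ∀ p q → fromℚᵘ (p ℚᵘ.+ q) ≡ fromℚᵘ p ℚ.+ fromℚᵘ q
fromℚᵘ-homo-+ p q = ℚ.toℚᵘ-injective (begin
  toℚᵘ (fromℚᵘ (p ℚᵘ.+ q))              ≈⟨ ℚ.toℚᵘ-fromℚᵘ (p ℚᵘ.+ q) ⟩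
  p ℚᵘ.+ q                               ≈⟨ ℚᵘ.+-cong (ℚ.toℚᵘ-fromℚᵘ p) (ℚ.toℚᵘ-fromℚᵘ q) ⟨
  toℚᵘ (fromℚᵘ p) ℚᵘ.+ toℚᵘ (fromℚᵘ q)  ≈⟨ ℚ.toℚᵘ-homo-+ (fromℚᵘ p) (fromℚᵘ q) ⟨
  toℚᵘ (fromℚᵘ p ℚ.+ fromℚᵘ q)          ∎)
  where open ℚᵘ.≃-Reasoning

fromℚᵘ-homo-* : ∀ p q → fromℚᵘ (p ℚᵘ.* q) ≡ fromℚᵘ p ℚ.* fromℚᵘ q
fromℚᵘ-homo-* p q = ℚ.toℚᵘ-injective (begin
  toℚᵘ (fromℚᵘ (p ℚᵘ.* q))              ≈⟨ ℚ.toℚᵘ-fromℚᵘ (p ℚᵘ.* q) ⟩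
  p ℚᵘ.* q                               ≈⟨ ℚᵘ.*-cong (ℚ.toℚᵘ-fromℚᵘ p) (ℚ.toℚᵘ-fromℚᵘ q) ⟨
  toℚᵘ (fromℚᵘ p) ℚᵘ.* toℚᵘ (fromℚᵘ q)  ≈⟨ ℚ.toℚᵘ-homo-* (fromℚᵘ p) (fromℚᵘ q) ⟨
  toℚᵘ (fromℚᵘ p ℚ.* fromℚᵘ q)          ∎)
  where open ℚᵘ.≃-Reasoning

fromℤ : ℤ → ℚ
fromℤ z = fromℚᵘ (mkℚᵘ z 0)

fromℤ-homo-+ : ∀ a b → fromℤ (a ℤ.+ b) ≡ fromℤ a ℚ.+ fromℤ b
fromℤ-homo-+ a b =
  trans (ℚ.fromℚᵘ-cong {mkℚᵘ (a ℤ.+ b) 0} {mkℚᵘ a 0 ℚᵘ.+ mkℚᵘ b 0} (*≡* e))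
        (fromℚᵘ-homo-+ (mkℚᵘ a 0) (mkℚᵘ b 0))
  where
  e : (a ℤ.+ b) ℤ.* + 1 ≡ (a ℤ.* + 1 ℤ.+ b ℤ.* + 1) ℤ.* + 1
  e = cong (ℤ._* + 1) (sym (cong₂ ℤ._+_ (ℤ.*-identityʳ a) (ℤ.*-identityʳ b)))

fromℤ-homo-* : ∀ a b → fromℤ (a ℤ.* b) ≡ fromℤ a ℚ.* fromℤ b
fromℤ-homo-* a b =
  trans (ℚ.fromℚᵘ-cong {mkℚᵘ (a ℤ.* b) 0} {mkℚᵘ a 0 ℚᵘ.* mkℚᵘ b 0} (*≡* refl))
        (fromℚᵘ-homo-* (mkℚᵘ a 0) (mkℚᵘ b 0))

fromℤ-injective : ∀ {a b} → fromℤ a ≡ fromℤ b → a ≡ b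
fromℤ-injective {a} {b} eq with ℚ.fromℚᵘ-injective {mkℚᵘ a 0} {mkℚᵘ b 0} eq
... | *≡* e = trans (sym (ℤ.*-identityʳ a)) (trans e (ℤ.*-identityʳ b))

fromℤ-↥ : ∀ q → fromℤ (↥ q) ≡ fromℤ (↧ q) ℚ.* q
fromℤ-↥ q@(ℚ.mkℚ n d-1 _) = begin
  fromℤ (↥ q)                        ≡⟨ ℚ.fromℚᵘ-cong {mkℚᵘ (↥ q) 0} {mkℚᵘ (↧ q) 0 ℚᵘ.* toℚᵘ q} (*≡* e) ⟩
  fromℚᵘ (mkℚᵘ (↧ q) 0 ℚᵘ.* toℚᵘ q)  ≡⟨ fromℚᵘ-homo-* (mkℚᵘ (↧ q) 0) (toℚᵘ q) ⟩
  fromℤ (↧ q) ℚ.* fromℚᵘ (toℚᵘ q)    ≡⟨ cong (fromℤ (↧ q) ℚ.*_) (ℚ.fromℚᵘ-toℚᵘ q) ⟩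
  fromℤ (↧ q) ℚ.* q                  ∎
  where
  open ≡-Reasoning
  e : n ℤ.* + (1 ℕ.* ℕ.suc d-1) ≡ (+ ℕ.suc d-1 ℤ.* n) ℤ.* + 1
  e = trans (cong (λ k → n ℤ.* + k) (ℕ.*-identityˡ (ℕ.suc d-1)))
        (trans (ℤ.*-comm n _) (sym (ℤ.*-identityʳ _)))

↧∣⇒integralMultiple : ∀ q {M} → ↧ₙ q ∣ M → Σ ℤ λ z → fromℤ z ≡ fromℤ (+ M) ℚ.* q
↧∣⇒integralMultiple q (divides k refl) = + k ℤ.* ↥ q , (begin
  fromℤ (+ k ℤ.* ↥ q)                   ≡⟨ fromℤ-homo-* (+ k) (↥ q) ⟩
  fromℤ (+ k) ℚ.* fromℤ (↥ q)           ≡⟨ cong (fromℤ (+ k) ℚ.*_) (fromℤ-↥ q) ⟩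
  fromℤ (+ k) ℚ.* (fromℤ (↧ q) ℚ.* q)   ≡⟨ ℚ.*-assoc (fromℤ (+ k)) (fromℤ (↧ q)) q ⟨
  fromℤ (+ k) ℚ.* fromℤ (↧ q) ℚ.* q     ≡⟨ cong (ℚ._* q) (fromℤ-homo-* (+ k) (↧ q)) ⟨
  fromℤ (+ k ℤ.* ↧ q) ℚ.* q             ≡⟨ cong (λ z → fromℤ z ℚ.* q) (ℤ.pos-* k (↧ₙ q)) ⟨
  fromℤ (+ (k ℕ.* ↧ₙ q)) ℚ.* q          ∎)
  where open ≡-Reasoning

commonDenominator : (qs : List ℚ) → Σ ℕ λ D → ℕ.NonZero D ×
  (∀ {q} → q List.∈ qs → Σ ℤ λ z → fromℤ z ≡ fromℤ (+ D) ℚ.* q)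
commonDenominator qs = product (map ↧ₙ_ qs)
  , product≢0 (All.map⁺ (All.universal (λ q → _) qs))
  , λ {q} q∈qs → ↧∣⇒integralMultiple q (∈⇒∣product (∈-map⁺ ↧ₙ_ q∈qs))

clearDenominators : ∀ {K m} (a : Fin K → Fin m → ℚ) → Σ ℕ λ D → ℕ.NonZero D ×
  Σ (Fin K → Fin m → ℤ) λ A → ∀ k g → fromℤ (A k g) ≡ fromℤ (+ D) ℚ.* a k g
clearDenominators {K} {m} a with commonDenominator (cartesianProductWith a (allFin K) (allFin m))
... | D , D≢0 , integral = D , D≢0 , (λ k g → proj₁ (lift k g)) , (λ k g → proj₂ (lift k g))
  where
  lift : ∀ k g → Σ ℤ λ z → fromℤ z ≡ fromℤ (+ D) ℚ.* a k g
  lift k g = integral (∈-cartesianProductWith⁺ a (∈-allFin k) (∈-allFin g))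

module _ (G : FinGroup) where
  open FinGroup G
  private
    module ℤ[G] = GroupAlgebra ℤ.+-*-isCommutativeRing G
    module ℚ[G] = GroupAlgebra ℚ.+-*-isCommutativeRing G

  sum-𝟙 : ∀ {m} (U : Subset m) → ℤ[G].sum (ℤ[G].𝟙 U) ≡ + ∣ U ∣
  sum-𝟙 []            = ℤ[G].sum-zero _
  sum-𝟙 (inside ∷ U)  = trans (ℤ[G].sum-suc _) (cong (ℤ._+_ (+ 1)) (sum-𝟙 U))
  sum-𝟙 (outside ∷ U) = trans (ℤ[G].sum-suc _) (trans (ℤ.+-identityˡ _) (sum-𝟙 U))

  sumℚ≡sum : ∀ {m} (f : Fin m → ℚ) → sumℚ f ≡ ℚ[G].sum f
  sumℚ≡sum {zero}  f = sym (ℚ[G].sum-zero f)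
  sumℚ≡sum {suc m} f = trans (cong (f zero ℚ.+_) (sumℚ≡sum (f ∘ suc))) (sym (ℚ[G].sum-suc f))

  fromℤ-sum : ∀ {m} (f : Fin m → ℤ) → fromℤ (ℤ[G].sum f) ≡ ℚ[G].sum (fromℤ ∘ f)
  fromℤ-sum {zero}  f = trans (cong fromℤ (ℤ[G].sum-zero f)) (sym (ℚ[G].sum-zero (fromℤ ∘ f)))
  fromℤ-sum {suc m} f = begin
    fromℤ (ℤ[G].sum f)                             ≡⟨ cong fromℤ (ℤ[G].sum-suc f) ⟩
    fromℤ (f zero ℤ.+ ℤ[G].sum (f ∘ suc))          ≡⟨ fromℤ-homo-+ (f zero) _ ⟩
    fromℤ (f zero) ℚ.+ fromℤ (ℤ[G].sum (f ∘ suc))  ≡⟨ cong (fromℤ (f zero) ℚ.+_) (fromℤ-sum (f ∘ suc)) ⟩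
    fromℤ (f zero) ℚ.+ ℚ[G].sum (fromℤ ∘ f ∘ suc)  ≡⟨ ℚ[G].sum-suc (fromℤ ∘ f) ⟨
    ℚ[G].sum (fromℤ ∘ f)                           ∎
    where open ≡-Reasoning

  fromℤ-∗ : ∀ a b → fromℤ ∘ (a ℤ[G].∗ b) ≗ (fromℤ ∘ a) ℚ[G].∗ (fromℤ ∘ b)
  fromℤ-∗ a b x = trans (fromℤ-sum (λ h → a h ℤ.* b (h ⁻¹ · x)))
                        (ℚ[G].sum-cong-≗ (λ h → fromℤ-homo-* (a h) _))

  fromℤ-𝟙 : ∀ (U : Subset n) → fromℤ ∘ ℤ[G].𝟙 U ≗ ℚ[G].𝟙 U
  fromℤ-𝟙 U x = side (lookup U x)
    where
    side : ∀ s → fromℤ (ℤ[G].side s) ≡ ℚ[G].side s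
    side inside  = refl
    side outside = refl

  Norm≗𝟙 : ∀ (U : Subset n) → Norm G U ≗ ℚ[G].𝟙 U
  Norm≗𝟙 U x = side (lookup U x)
    where
    side : ∀ s → sideℚ G s ≡ ℚ[G].side s
    side inside  = refl
    side outside = refl

  *G≗∗ : ∀ a b → _*G_ G a b ≗ a ℚ[G].∗ b
  *G≗∗ a b x = sumℚ≡sum (λ h → a h ℚ.* b (h ⁻¹ · x))

  normRelation-∗ : ∀ {H : Subset n} {ℓ} {J : Fin ℓ → Subset n} {K}
    (idx : Fin K → Fin ℓ) (a b : Fin K → QG G) →
    (∀ g → Norm G H g ≡ sumℚ (λ k → _*G_ G (_*G_ G (a k) (Norm G (J (idx k)))) (b k) g)) →
    ∀ y → ℚ[G].𝟙 H y ≡ ℚ[G].sum (λ k → ((a k ℚ[G].∗ ℚ[G].𝟙 (J (idx k))) ℚ[G].∗ b k) y)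
  normRelation-∗ {H} {J = J} idx a b rel y = begin
    ℚ[G].𝟙 H y                                                       ≡⟨ Norm≗𝟙 H y ⟨
    Norm G H y                                                       ≡⟨ rel y ⟩
    sumℚ (λ k → _*G_ G (_*G_ G (a k) (Norm G (J (idx k)))) (b k) y)  ≡⟨ sumℚ≡sum _ ⟩
    ℚ[G].sum (λ k → _*G_ G (_*G_ G (a k) (Norm G (J (idx k)))) (b k) y)
      ≡⟨ ℚ[G].sum-cong-≗ (λ k → trans (*G≗∗ (_*G_ G (a k) (Norm G (J (idx k)))) (b k) y)
           (ℚ[G].∗-congʳ (b k) (λ z → trans (*G≗∗ (a k) (Norm G (J (idx k))) z)
                                            (ℚ[G].∗-congˡ (a k) (Norm≗𝟙 (J (idx k))) z)) y)) ⟩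
    ℚ[G].sum (λ k → ((a k ℚ[G].∗ ℚ[G].𝟙 (J (idx k))) ℚ[G].∗ b k) y) ∎
    where open ≡-Reasoning

record IntegralNormRelation (G : FinGroup) (H : Subset (FinGroup.n G))
                            (ℓ : ℕ) (J : Fin ℓ → Subset (FinGroup.n G)) : Set where
  open GroupAlgebra ℤ.+-*-isCommutativeRing G using (sum; _∗_; 𝟙)
  field
    K        : ℕ
    idx      : Fin K → Fin ℓ
    A B      : Fin K → Fin (FinGroup.n G) → ℤ
    d        : ℕ
    d≢0      : ℕ.NonZero d
    relation : ∀ y → sum (λ k → ((A k ∗ 𝟙 (J (idx k))) ∗ B k) y) ≡ + d ℤ.* 𝟙 H y

module _ {G : FinGroup} {H : Subset (FinGroup.n G)} {ℓ} {J : Fin ℓ → Subset (FinGroup.n G)} where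
  open FinGroup G
  private
    module ℤ[G] = GroupAlgebra ℤ.+-*-isCommutativeRing G
    module ℚ[G] = GroupAlgebra ℚ.+-*-isCommutativeRing G

  normRelation⇒integral : NormRelation G H ℓ J → IntegralNormRelation G H ℓ J
  normRelation⇒integral (K , idx , a , b , rel)
    with clearDenominators a | clearDenominators b
  ... | Da , Da≢0 , A , fromℤ-A | Db , Db≢0 , B , fromℤ-B = record
    { K = K ; idx = idx ; A = A ; B = B ; d = Da ℕ.* Db
    ; d≢0 = ℕ.m*n≢0 Da Db {{Da≢0}} {{Db≢0}}
    ; relation = λ y → fromℤ-injective (scaled y) }
    where
    open ℚ[G]
    da db c : ℚ
    da = fromℤ (+ Da)
    db = fromℤ (+ Db)
    c = da ℚ.* db
    term : ∀ k → (Fin n → ℚ)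
    term k = (a k ∗ 𝟙 (J (idx k))) ∗ b k
    lift : ∀ k → fromℤ ∘ ((A k ℤ[G].∗ ℤ[G].𝟙 (J (idx k))) ℤ[G].∗ B k) ≗ λ y → c ℚ.* term k y
    lift k y = begin
      fromℤ (((A k ℤ[G].∗ ℤ[G].𝟙 (J (idx k))) ℤ[G].∗ B k) y)
        ≡⟨ fromℤ-∗ G (A k ℤ[G].∗ ℤ[G].𝟙 (J (idx k))) (B k) y ⟩
      ((fromℤ ∘ (A k ℤ[G].∗ ℤ[G].𝟙 (J (idx k)))) ∗ (fromℤ ∘ B k)) y
        ≡⟨ ∗-cong (λ z → trans (fromℤ-∗ G (A k) (ℤ[G].𝟙 (J (idx k))) z)
                               (∗-cong (fromℤ-A k) (fromℤ-𝟙 G (J (idx k))) z))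
                  (fromℤ-B k) y ⟩
      (((λ g → da ℚ.* a k g) ∗ 𝟙 (J (idx k))) ∗ (λ g → db ℚ.* b k g)) y
        ≡⟨ ∗-congʳ (λ g → db ℚ.* b k g) (∗-scaleˡ da (a k) (𝟙 (J (idx k)))) y ⟩
      ((λ g → da ℚ.* (a k ∗ 𝟙 (J (idx k))) g) ∗ (λ g → db ℚ.* b k g)) y
        ≡⟨ ∗-scale da db (a k ∗ 𝟙 (J (idx k))) (b k) y ⟩
      c ℚ.* term k y ∎
      where open ≡-Reasoning
    scaled : ∀ y → fromℤ (ℤ[G].sum (λ k → ((A k ℤ[G].∗ ℤ[G].𝟙 (J (idx k))) ℤ[G].∗ B k) y))
                 ≡ fromℤ (+ (Da ℕ.* Db) ℤ.* ℤ[G].𝟙 H y)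
    scaled y = begin
      fromℤ (ℤ[G].sum (λ k → ((A k ℤ[G].∗ ℤ[G].𝟙 (J (idx k))) ℤ[G].∗ B k) y))
        ≡⟨ fromℤ-sum G _ ⟩
      sum (λ k → fromℤ (((A k ℤ[G].∗ ℤ[G].𝟙 (J (idx k))) ℤ[G].∗ B k) y))
        ≡⟨ sum-cong-≗ (λ k → lift k y) ⟩
      sum (λ k → c ℚ.* term k y)     ≡⟨ *-distribˡ-sum c (λ k → term k y) ⟨
      c ℚ.* sum (λ k → term k y)     ≡⟨ cong (c ℚ.*_) (normRelation-∗ G {H} {J = J} idx a b rel y) ⟨
      c ℚ.* 𝟙 H y                    ≡⟨ cong₂ ℚ._*_ (fromℤ-homo-* (+ Da) (+ Db)) (fromℤ-𝟙 G H y) ⟨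
      fromℤ (+ Da ℤ.* + Db) ℚ.* fromℤ (ℤ[G].𝟙 H y) ≡⟨ fromℤ-homo-* (+ Da ℤ.* + Db) (ℤ[G].𝟙 H y) ⟨
      fromℤ (+ Da ℤ.* + Db ℤ.* ℤ[G].𝟙 H y)
        ≡⟨ cong (λ z → fromℤ (z ℤ.* ℤ[G].𝟙 H y)) (ℤ.pos-* Da Db) ⟨
      fromℤ (+ (Da ℕ.* Db) ℤ.* ℤ[G].𝟙 H y) ∎
      where open ≡-Reasoning

vectors : ∀ {A : Set} → List A → (m : ℕ) → List (Vec A m)
vectors xs zero    = [] ∷ []
vectors xs (suc m) = cartesianProductWith _∷_ xs (vectors xs m)

∈-vectors : ∀ {A : Set} {xs : List A} → (∀ x → x List.∈ xs) →
  ∀ {m} (v : Vec A m) → v List.∈ vectors xs m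
∈-vectors ∈xs []      = here refl
∈-vectors ∈xs (x ∷ v) = ∈-cartesianProductWith⁺ _∷_ (∈xs x) (∈-vectors ∈xs v)

module _ (G : FinGroup) (H : Subset (FinGroup.n G)) (c : ℕ) {{c≢0 : ℕ.NonZero c}} where
  open FinGroup G

  rightInvariant? : (v : Vec (Fin c) n) → Dec (∀ g h → h ∈ H → lookup v (g · h) ≡ lookup v g)
  rightInvariant? v =
    Fin.all? λ g → Fin.all? λ h → (h ∈? H) →-dec (lookup v (g · h) Fin.≟ lookup v g)

  -- A vector of residues that is not right H-invariant is no element of ℤ[G/H]; it is sent to 0.
  fromResidues : Vec (Fin c) n → Perm G H
  fromResidues v with rightInvariant? v
  ... | yes inv = (λ g → + toℕ (lookup v g)) , λ g h h∈H → cong (λ r → + toℕ r) (inv g h h∈H)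
  ... | no _    = (λ _ → + 0) , λ _ _ _ → refl

  residues : Perm G H → Vec (Fin c) n
  residues (f , _) = tabulate λ g → fromℕ< (n%ℕd<d (f g) c)

  fromResidues-residues : ∀ x g → proj₁ (fromResidues (residues x)) g ≡ + (proj₁ x g %ℕ c)
  fromResidues-residues x@(f , f-inv) g with rightInvariant? (residues x)
  ... | yes _ = cong +_ (trans (cong toℕ (lookup∘tabulate _ g)) (Fin.toℕ-fromℕ< _))
  ... | no ¬inv = ⊥-elim (¬inv λ g h h∈H → begin
    lookup (residues x) (g · h)             ≡⟨ lookup∘tabulate _ (g · h) ⟩
    fromℕ< (n%ℕd<d (f (g · h)) c)           ≡⟨ cong (λ z → fromℕ< (n%ℕd<d z c)) (f-inv g h h∈H) ⟩
    fromℕ< (n%ℕd<d (f g) c)                 ≡⟨ lookup∘tabulate _ g ⟨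
    lookup (residues x) g                   ∎)
    where open ≡-Reasoning

  module _ {M : ZGMod G} {φ : ZGMod.Carrier M → Perm G H} (ψ : Perm G H → ZGMod.Carrier M) where

    -- x = (x mod c) + c (x div c), and c (x div c) = φ (ψ (x div c)).
    retraction⇒finiteIndex : (∀ x → _≈P_ G (φ (ψ x)) (scalP G (+ c) x)) →
      FiniteIndexImage M (PermMod G H) φ
    retraction⇒finiteIndex φψ≈c =
      map fromResidues (vectors (allFin c) n) , λ x →
        List.lose (∈-map⁺ fromResidues (∈-vectors ∈-allFin (residues x)))
                  (ψ (quotient x) , decompose x)
      where
      quotient : Perm G H → Perm G H
      quotient (f , f-inv) = (λ g → f g /ℕ c) , λ g h h∈H → cong (_/ℕ c) (f-inv g h h∈H)

      decompose : ∀ x g →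
        proj₁ x g ≡ proj₁ (fromResidues (residues x)) g ℤ.+ proj₁ (φ (ψ (quotient x))) g
      decompose x@(f , _) g = begin
        f g                                     ≡⟨ a≡a%ℕn+[a/ℕn]*n (f g) c ⟩
        + (f g %ℕ c) ℤ.+ (f g /ℕ c) ℤ.* + c
          ≡⟨ cong₂ ℤ._+_ (fromResidues-residues x g) (ℤ.*-comm (+ c) (f g /ℕ c)) ⟨
        r ℤ.+ + c ℤ.* (f g /ℕ c)                ≡⟨ cong (λ z → r ℤ.+ z) (φψ≈c (quotient x) g) ⟨
        r ℤ.+ proj₁ (φ (ψ (quotient x))) g      ∎
        where
        open ≡-Reasoning
        r = proj₁ (fromResidues (residues x)) g

    retraction⇒injective : IsHom M (PermMod G H) φ → (∀ x → _≈P_ G (φ (ψ x)) (scalP G (+ c) x)) →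
      Injective (PermMod G H) M ψ
    retraction⇒injective φ-hom φψ≈c x y ψx≈ψy g = ℤ.*-cancelˡ-≡ (+ c) (proj₁ x g) (proj₁ y g)
      (trans (sym (φψ≈c x g)) (trans (IsHom.cong-≈ φ-hom ψx≈ψy g) (φψ≈c y g)))

x∈p⇒∣p∣≢0 : ∀ {m} {x : Fin m} {p : Subset m} → x ∈ p → ℕ.NonZero ∣ p ∣
x∈p⇒∣p∣≢0 here                            = _
x∈p⇒∣p∣≢0 {p = inside  ∷ p} (there x∈p) = _
x∈p⇒∣p∣≢0 {p = outside ∷ p} (there x∈p) = x∈p⇒∣p∣≢0 x∈p

module Splitting {G : FinGroup} {H : Subset (FinGroup.n G)} (H≤G : IsSubgroup G H)
                 {ℓ} {J : Fin ℓ → Subset (FinGroup.n G)} (J≤G : ∀ i → IsSubgroup G (J i))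
                 (R : IntegralNormRelation G H ℓ J) where
  open FinGroup G
  open IntegralNormRelation R
  open GroupAlgebra ℤ.+-*-isCommutativeRing G

  -- ψ has one copy of ℤ[G/J i] for every term k of the relation; φ reads only those with i = idx k.
  multiplicities : Fin ℓ → ℕ
  multiplicities _ = K

  private
    ℤ[G/H] = PermMod G H
    ⊕ℤ[G/J] = SumMod G ℓ J multiplicities

  c : ℕ
  c = d ℕ.* ∣ H ∣ ℕ.* ∣ H ∣

  instance
    c≢0 : ℕ.NonZero c
    c≢0 = ℕ.m*n≢0 _ _ {{ℕ.m*n≢0 d _ {{d≢0}} {{x∈p⇒∣p∣≢0 (IsSubgroup.ε∈ H≤G)}}}}
                       {{x∈p⇒∣p∣≢0 (IsSubgroup.ε∈ H≤G)}}

  ψ : ZGMod.Carrier ℤ[G/H] → ZGMod.Carrier ⊕ℤ[G/J]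
  ψ (f , _) i k = f ∗ (A k ∗ 𝟙 (J i)) ,
    ∗-rightInvariant f (∗-rightInvariant (A k) (𝟙-rightInvariant (J≤G i)))

  φ : ZGMod.Carrier ⊕ℤ[G/J] → ZGMod.Carrier ℤ[G/H]
  φ F = (λ x → sum (λ k → (proj₁ (F (idx k) k) ∗ (B k ∗ 𝟙 H)) x)) ,
    λ x h h∈H → sum-cong-≗ (λ k → ∗-rightInvariant (proj₁ (F (idx k) k))
                                     (∗-rightInvariant (B k) (𝟙-rightInvariant H≤G)) x h h∈H)

  ψ-isHom : IsHom ℤ[G/H] ⊕ℤ[G/J] ψ
  ψ-isHom = record
    { cong-≈ = λ x≈y i k → ∗-congʳ (A k ∗ 𝟙 (J i)) x≈y
    ; hom-+  = λ x y i k → ∗-distribʳ-+ (proj₁ x) (proj₁ y) (A k ∗ 𝟙 (J i))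
    ; hom-G  = λ g x i k → ∗-translateˡ g (proj₁ x) (A k ∗ 𝟙 (J i))
    }

  φ-isHom : IsHom ⊕ℤ[G/J] ℤ[G/H] φ
  φ-isHom = record
    { cong-≈ = λ F≈F' x → sum-cong-≗ (λ k → ∗-congʳ (B k ∗ 𝟙 H) (F≈F' (idx k) k) x)
    ; hom-+  = λ F F' x → trans (sum-cong-≗ (λ k → ∗-distribʳ-+ (f F k) (f F' k) (B k ∗ 𝟙 H) x))
                                (∑-distrib-+ (λ k → (f F k ∗ (B k ∗ 𝟙 H)) x)
                                             (λ k → (f F' k ∗ (B k ∗ 𝟙 H)) x))
    ; hom-G  = λ g F x → sum-cong-≗ (λ k → ∗-translateˡ g (f F k) (B k ∗ 𝟙 H) x)
    }
    where
    f : ZGMod.Carrier ⊕ℤ[G/J] → Fin K → Fin n → ℤ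
    f F k = proj₁ (F (idx k) k)

  φ∘ψ≈c : ∀ x → _≈P_ G (φ (ψ x)) (scalP G (+ c) x)
  φ∘ψ≈c (f , f-inv) y = begin
    sum (λ k → ((f ∗ α k) ∗ (B k ∗ 𝟙 H)) y)
      ≡⟨ sum-cong-≗ (λ k → trans (∗-assoc f (α k) (B k ∗ 𝟙 H) y)
                                  (∗-congˡ f (λ z → sym (∗-assoc (α k) (B k) (𝟙 H) z)) y)) ⟩
    sum (λ k → (f ∗ ((α k ∗ B k) ∗ 𝟙 H)) y)
      ≡⟨ ∗-sumʳ f (λ k → (α k ∗ B k) ∗ 𝟙 H) y ⟨
    (f ∗ (λ z → sum (λ k → ((α k ∗ B k) ∗ 𝟙 H) z))) y
      ≡⟨ ∗-congˡ f (∗-sumˡ (λ k → α k ∗ B k) (𝟙 H)) y ⟨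
    (f ∗ ((λ w → sum (λ k → (α k ∗ B k) w)) ∗ 𝟙 H)) y
      ≡⟨ ∗-congˡ f (∗-congʳ (𝟙 H) relation) y ⟩
    (f ∗ ((λ w → + d ℤ.* 𝟙 H w) ∗ 𝟙 H)) y
      ≡⟨ ∗-congˡ f (∗-scaleˡ (+ d) (𝟙 H) (𝟙 H)) y ⟩
    (f ∗ (λ w → + d ℤ.* (𝟙 H ∗ 𝟙 H) w)) y
      ≡⟨ ∗-scaleʳ (+ d) f (𝟙 H ∗ 𝟙 H) y ⟩
    + d ℤ.* (f ∗ (𝟙 H ∗ 𝟙 H)) y
      ≡⟨ cong (+ d ℤ.*_) (∗-assoc f (𝟙 H) (𝟙 H) y) ⟨
    + d ℤ.* ((f ∗ 𝟙 H) ∗ 𝟙 H) y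
      ≡⟨ cong (+ d ℤ.*_) (∗-𝟙 H≤G (∗-rightInvariant f (𝟙-rightInvariant H≤G)) y) ⟩
    + d ℤ.* (sum (𝟙 H) ℤ.* (f ∗ 𝟙 H) y)
      ≡⟨ cong (λ z → + d ℤ.* (sum (𝟙 H) ℤ.* z)) (∗-𝟙 H≤G f-inv y) ⟩
    + d ℤ.* (sum (𝟙 H) ℤ.* (sum (𝟙 H) ℤ.* f y))
      ≡⟨ cong (λ z → + d ℤ.* (z ℤ.* (z ℤ.* f y))) (sum-𝟙 G H) ⟩
    + d ℤ.* (+ ∣ H ∣ ℤ.* (+ ∣ H ∣ ℤ.* f y))
      ≡⟨ reassociate (+ d) (+ ∣ H ∣) (f y) ⟩
    + d ℤ.* + ∣ H ∣ ℤ.* + ∣ H ∣ ℤ.* f y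
      ≡⟨ cong (ℤ._* f y) c-expand ⟨
    + c ℤ.* f y                                     ∎
    where
    open ≡-Reasoning
    α : Fin K → Fin n → ℤ
    α k = A k ∗ 𝟙 (J (idx k))
    reassociate : ∀ a b z → a ℤ.* (b ℤ.* (b ℤ.* z)) ≡ a ℤ.* b ℤ.* b ℤ.* z
    reassociate = solve-∀
    c-expand : + c ≡ + d ℤ.* + ∣ H ∣ ℤ.* + ∣ H ∣
    c-expand = trans (ℤ.pos-* (d ℕ.* ∣ H ∣) ∣ H ∣) (cong (ℤ._* + ∣ H ∣) (ℤ.pos-* d ∣ H ∣))

mainTheorem9 : (G : FinGroup) (H : Subset (FinGroup.n G)) → IsSubgroup G H →
    (ℓ : ℕ) (J : Fin ℓ → Subset (FinGroup.n G)) →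
    (∀ i → IsSubgroup G (J i)) → (∀ i → NonTrivial G (J i)) →
    NormRelation G H ℓ J →
    Σ ℕ λ c → 1 ≤ c × (Σ (Fin ℓ → ℕ) λ ns →
      Σ (ZGMod.Carrier (PermMod G H) → ZGMod.Carrier (SumMod G ℓ J ns)) λ ψ →
      Σ (ZGMod.Carrier (SumMod G ℓ J ns) → ZGMod.Carrier (PermMod G H)) λ φ →
        IsHom (PermMod G H) (SumMod G ℓ J ns) ψ ×
        Injective (PermMod G H) (SumMod G ℓ J ns) ψ ×
        IsHom (SumMod G ℓ J ns) (PermMod G H) φ ×
        FiniteIndexImage (SumMod G ℓ J ns) (PermMod G H) φ ×
        (∀ x → ZGMod._≈_ (PermMod G H) (φ (ψ x)) (ZGMod.scal (PermMod G H) (+ c) x)))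
mainTheorem9 G H H≤G ℓ J J≤G _ rel =
  c , ℕ.>-nonZero⁻¹ c , multiplicities , ψ , φ ,
  ψ-isHom , retraction⇒injective G H c ψ φ-isHom φ∘ψ≈c ,
  φ-isHom , retraction⇒finiteIndex G H c {SumMod G ℓ J multiplicities} {φ} ψ φ∘ψ≈c ,
  φ∘ψ≈c
  where open Splitting H≤G J≤G (normRelation⇒integral rel)
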